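{- With probability $1-o(1)$ (as $h\to\infty$), an input chosen according to $D_N$ is $1/12$-far from satisfying the monotone sub-balancing formula of height $h$.
   Context: Alphabet $\Sigma=\{0,F_0,P,F_1,1\}$. The monotone balancing gate takes two inputs from $\Sigma$ and outputs: $0$ on $(0,0)$; $1$ on $(1,1)$; $P$ on $(1,0)$, $(0,1)$, $(P,P)$; $F_0$ on $(0,P)$, $(P,0)$, $(P,F_0)$, $(F_0,P)$, $(F_0,0)$, $(0,F_0)$, $(F_0,F_0)$; $F_1$ on $(1,P)$, $(P,1)$, $(F_0,1)$, $(1,F_0)$, and on every pair containing $F_1$. The monotone sub-balancing formula of height $h$ is the full balanced binary tree of height $h$ with leaves $x_0,\dots,x_{2^h-1}$ in left-to-right order and all internal gates monotone balancing gates; an assignment in $\{0,1\}^{2^h}$ satisfies it iff the root value is neither $F_1$ nor $1$. Being $1/12$-far means differing from every satisfying assignment in more than $2^h/12$ variables. Distribution $D_N$: pick $k$ uniformly from $\{2,\dots,h\}$; for every $0\le i<2^{h-k}$ independently pick $(z_{i,0},\dots,z_{i,3})$ uniformly among the $8$ vectors in $\{0,1\}^4$ with exactly one $1$ or exactly one $0$; set the four consecutive quarters (each of length $2^{k-2}$) of the block $x_{i2^k},\dots,x_{(i+1)2^k-1}$ constantly to $z_{i,0},z_{i,1},z_{i,2},z_{i,3}$ respectively. -}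

module Defs where

open import Data.Bool using (Bool; true; false; not; if_then_else_; _xor_)
open import Data.Nat using (ℕ; zero; suc; _+_; _*_; _∸_; _^_; _<_; _≤_; _<ᵇ_; _≡ᵇ_; _<?_)
open import Data.Nat.DivMod using (_%_) renaming (_/_ to _div_)
open import Data.Nat.Properties using (m^n≢0)
open import Data.Fin using (Fin; zero; suc; toℕ; _↑ˡ_; _↑ʳ_)
open import Data.Vec using (Vec; []; _∷_; lookup; tabulate)
open import Data.List using (List; map; allFin)
open import Data.Nat.ListAction using (sum)
open import Data.Product using (_×_; _,_)
open import Data.Rational using (ℚ)
import Data.Rational as ℚ
import Data.Integer as ℤ
open import Relation.Binary.PropositionalEquality using (_≡_; _≢_; refl)
open import Relation.Nullary using (Dec; yes; no; ¬_; does)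
open import Relation.Nullary.Decidable using (_×-dec_; _→-dec_; ¬?)

data Sym : Set where
  s0 F0 P F1 s1 : Sym

_≟S_ : (a b : Sym) → Dec (a ≡ b)
s0 ≟S s0 = yes refl
F0 ≟S F0 = yes refl
P  ≟S P  = yes refl
F1 ≟S F1 = yes refl
s1 ≟S s1 = yes refl
s0 ≟S F0 = no λ ()
s0 ≟S P  = no λ ()
s0 ≟S F1 = no λ ()
s0 ≟S s1 = no λ ()
F0 ≟S s0 = no λ ()
F0 ≟S P  = no λ ()
F0 ≟S F1 = no λ ()
F0 ≟S s1 = no λ ()
P  ≟S s0 = no λ ()
P  ≟S F0 = no λ ()
P  ≟S F1 = no λ ()
P  ≟S s1 = no λ ()
F1 ≟S s0 = no λ ()
F1 ≟S F0 = no λ ()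
F1 ≟S P  = no λ ()
F1 ≟S s1 = no λ ()
s1 ≟S s0 = no λ ()
s1 ≟S F0 = no λ ()
s1 ≟S P  = no λ ()
s1 ≟S F1 = no λ ()

gate : Sym → Sym → Sym
gate F1 _  = F1
gate _  F1 = F1
gate s0 s0 = s0
gate s1 s1 = s1
gate s1 s0 = P
gate s0 s1 = P
gate P  P  = P
gate s0 P  = F0
gate P  s0 = F0
gate P  F0 = F0
gate F0 P  = F0
gate F0 s0 = F0
gate s0 F0 = F0
gate F0 F0 = F0
gate s1 P  = F1
gate P  s1 = F1
gate F0 s1 = F1
gate s1 F0 = F1

leaf : Bool → Sym
leaf false = s0
leaf true  = s1

-- Monotone sub-balancing formula of height h: full balanced binary tree,
-- leaves x₀,…,x_{2^h-1} left to right (left subtree: indices < 2^h,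
-- right subtree: indices 2^h + i).

evalF : (h : ℕ) → (Fin (2 ^ h) → Bool) → Sym
evalF zero    x = leaf (x zero)
evalF (suc h) x =
  gate (evalF h (λ i → x (i ↑ˡ (2 ^ h + 0))))
       (evalF h (λ i → x (2 ^ h ↑ʳ (i ↑ˡ 0))))

root : (h : ℕ) → Vec Bool (2 ^ h) → Sym
root h v = evalF h (lookup v)

Satisfies : (h : ℕ) → Vec Bool (2 ^ h) → Set
Satisfies h v = (root h v ≢ F1) × (root h v ≢ s1)

dist : ∀ {n} → Vec Bool n → Vec Bool n → ℕ
dist []       []       = 0
dist (a ∷ as) (b ∷ bs) = (if a xor b then 1 else 0) + dist as bs

Far : (h : ℕ) → Vec Bool (2 ^ h) → Set
Far h x = (y : Vec Bool (2 ^ h)) → Satisfies h y → 2 ^ h < 12 * dist x y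

allVec? : ∀ n (Q : Vec Bool n → Set) → (∀ v → Dec (Q v)) → Dec (∀ v → Q v)
allVec? zero Q d with d []
... | yes q = yes λ { [] → q }
... | no ¬q = no λ f → ¬q (f [])
allVec? (suc n) Q d
  with allVec? n (λ v → Q (true ∷ v)) (λ v → d (true ∷ v))
     | allVec? n (λ v → Q (false ∷ v)) (λ v → d (false ∷ v))
... | yes t | yes f = yes λ { (true ∷ v) → t v ; (false ∷ v) → f v }
... | no ¬t | _     = no λ g → ¬t (λ v → g (true ∷ v))
... | yes _ | no ¬f = no λ g → ¬f (λ v → g (false ∷ v))

satisfies? : ∀ h v → Dec (Satisfies h v)
satisfies? h v = ¬? (root h v ≟S F1) ×-dec ¬? (root h v ≟S s1)

far? : ∀ h x → Dec (Far h x)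
far? h x = allVec? (2 ^ h) _ λ y →
  satisfies? h y →-dec (2 ^ h <? 12 * dist x y)

-- The 8 vectors in {0,1}^4 with exactly one 1 or exactly one 0 are indexed
-- by c : Fin 8: for c < 4 the vector with a single 1 at position c, for
-- c ≥ 4 the vector with a single 0 at position c - 4.

pattern8 : Fin 8 → ℕ → Bool
pattern8 c q = if toℕ c <ᵇ 4 then (toℕ c ≡ᵇ q) else not ((toℕ c ∸ 4) ≡ᵇ q)

-- lookup with a default (the default is never used for indices in range)
at : ∀ {m} → Vec (Fin 8) m → ℕ → Fin 8
at []      _       = zero
at (c ∷ _) zero    = c
at (_ ∷ v) (suc n) = at v n

-- The input produced for k = 2 + t and block choices z (z_i ∈ the 8 vectors),
-- h = 2 + t + m, so there are 2^(h-k) = 2^m blocks of length 2^k, each split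
-- into four quarters of length 2^(k-2) = 2^t.
inputBit : (t : ℕ) → ∀ {m} → Vec (Fin 8) m → ℕ → Bool
inputBit t z j =
  pattern8 (at z (_div_ j (2 ^ (2 + t)) {{m^n≢0 2 (2 + t)}}))
           (_div_ (_%_ j (2 ^ (2 + t)) {{m^n≢0 2 (2 + t)}}) (2 ^ t) {{m^n≢0 2 t}})

input : (t m : ℕ) → Vec (Fin 8) (2 ^ m) → Vec Bool (2 ^ (2 + t + m))
input t m z = tabulate λ j → inputBit t z (toℕ j)

count : ∀ m → (Vec (Fin 8) m → Bool) → ℕ
count zero    Q = if Q [] then 1 else 0
count (suc m) Q = sum (map (λ c → count m (λ v → Q (c ∷ v))) (allFin 8))

sumℚ : ℕ → (ℕ → ℚ) → ℚ
sumℚ zero    f = f 0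
sumℚ (suc n) f = sumℚ n f ℚ.+ f (suc n)

-- Pr_{x ∼ D_N}[x is 1/12-far] for height h = 2 + n:
-- k = 2 + t uniform over t ∈ {0,…,n} (i.e. k ∈ {2,…,h}), then the 2^(h-k)
-- block vectors uniform and independent among the 8 choices.
probFar : (n : ℕ) → ℚ
probFar n =
  (ℤ.+ 1 ℚ./ suc n) ℚ.*
  sumℚ n (λ t →
    ℚ._/_ (ℤ.+ count (2 ^ (n ∸ t))
                   (λ z → does (far? (2 + t + (n ∸ t)) (input t (n ∸ t) z))))
        (8 ^ (2 ^ (n ∸ t))) {{m^n≢0 8 (2 ^ (n ∸ t))}})

module Submission where

-- 1. The value of a subformula constrains its number of ones (0: none, 1: all,
--    F₀ and P: at most half), and F₁ is absorbing.  So if y satisfies the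
--    formula, every block of length 2^(j+1) of y has at most half or only ones,
--    and the distance from x to y is at least the total "defect" of the blocks
--    of x (blockDefects≤hamming).
-- 2. For an input of D_N with k = t + 2, a block whose pattern has three ones
--    has defect 2^t and one with a single one has defect 0; hence the input is
--    1/12-far once more than a third of its N = 2^(h-k) blocks are heavy
--    (far-input).
-- 3. The number of heavy blocks is Binomial(N, 1/2): its first two moments and
--    Chebyshev's inequality leave at most 9 · 8^N / N bad choices (chebyshev).
-- 4. Averaging the resulting bounds 1 - 9 / 2^(n - t) over k gives
--    probFar n ≥ 1 - 18 / (n + 1) (probFar-bound), whence the lemma.

open import Defs
open import Data.Bool using (Bool; true; false; not; if_then_else_; _xor_)
open import Data.Bool.Properties using (xor-comm)
open import Data.Nat using (ℕ; zero; suc; pred; _+_; _*_; _∸_; _^_; _≤_; _<_; _≤ᵇ_; _⊓_; z≤n; s≤s; z<s; s<s; NonZero; _<?_)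
open import Data.Nat.Properties
open import Data.Nat.DivMod using (_%_; +-distrib-/-∣ˡ; n/n≡1; m*n/n≡m; m<n⇒m/n≡0; [m+kn]%n≡m%n; m<n⇒m%n≡m)
  renaming (_/_ to _div_)
open import Data.Nat.Divisibility using (∣-refl; n∣m*n)
open import Data.Nat.Coprimality using (Coprime)
open import Data.Nat.Tactic.RingSolver using (solve-∀)
open import Data.Fin using (Fin; zero; suc; toℕ; _↑ˡ_; _↑ʳ_)
open import Data.Fin.Properties using (toℕ-↑ˡ; toℕ-↑ʳ)
open import Data.Vec using (Vec; []; _∷_; lookup)
open import Data.Vec.Properties using (lookup∘tabulate)
open import Data.Product using (∃-syntax; _×_; _,_; proj₁; proj₂)
open import Data.Sum using (_⊎_; inj₁; inj₂)
open import Data.Unit using (⊤; tt)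
open import Data.Empty using (⊥-elim)
import Data.Integer as ℤ
import Data.Integer.Properties as ℤP
open import Data.Rational using (ℚ; Positive; 1ℚ; _-_; mkℚ; _/_; toℚᵘ)
  renaming (_≤_ to _≤ℚ_; _+_ to _+ℚ_; _*_ to _*ℚ_)
import Data.Rational as ℚ
import Data.Rational.Properties as ℚP
import Data.Rational.Unnormalised as ℚᵘ
open import Data.Rational.Unnormalised using (mkℚᵘ; *≤*) renaming (_≃_ to _≃ᵘ_)
import Data.Rational.Unnormalised.Properties as ℚᵘP
open import Algebra.Bundles using (CommutativeMonoid)
open import Algebra.Properties.CommutativeSemigroup (CommutativeMonoid.commutativeSemigroup ℚP.+-0-commutativeMonoid)
  using () renaming (interchange to +ℚ-interchange; xy∙z≈xz∙y to +ℚ-swap)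
open import Relation.Binary.PropositionalEquality
open import Relation.Nullary using (Dec; yes; no; does)
open import Relation.Nullary.Decidable using (dec-true)

χ : Bool → ℕ
χ b = if b then 1 else 0

Σ< : ℕ → (ℕ → ℕ) → ℕ
Σ< zero    f = 0
Σ< (suc n) f = f 0 + Σ< n (λ i → f (suc i))

Σ<-cong : ∀ n {f g : ℕ → ℕ} → (∀ i → i < n → f i ≡ g i) → Σ< n f ≡ Σ< n g
Σ<-cong zero    f≡g = refl
Σ<-cong (suc n) f≡g = cong₂ _+_ (f≡g 0 z<s) (Σ<-cong n (λ i i<n → f≡g (suc i) (s<s i<n)))

Σ<-const : ∀ n k → Σ< n (λ _ → k) ≡ n * k
Σ<-const zero    k = refl
Σ<-const (suc n) k = cong (k +_) (Σ<-const n k)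

Σ<-*ˡ : ∀ n k f → Σ< n (λ i → k * f i) ≡ k * Σ< n f
Σ<-*ˡ zero    k f = sym (*-zeroʳ k)
Σ<-*ˡ (suc n) k f = trans (cong (k * f 0 +_) (Σ<-*ˡ n k (λ i → f (suc i))))
                          (sym (*-distribˡ-+ k (f 0) _))

Σ<-++ : ∀ a b f → Σ< (a + b) f ≡ Σ< a f + Σ< b (λ i → f (a + i))
Σ<-++ zero    b f = refl
Σ<-++ (suc a) b f = trans (cong (f 0 +_) (Σ<-++ a b (λ i → f (suc i))))
                          (sym (+-assoc (f 0) _ _))

-- A function of ⌊i / Q⌋ summed over q·Q indices: each value is taken Q times.
Σ<-div : ∀ q Q .{{_ : NonZero Q}} (f : ℕ → ℕ) →
  Σ< (q * Q) (λ i → f (i div Q)) ≡ Q * Σ< q f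
Σ<-div zero    Q f = sym (*-zeroʳ Q)
Σ<-div (suc q) Q f = begin
  Σ< (Q + q * Q) (λ i → f (i div Q))
    ≡⟨ Σ<-++ Q (q * Q) _ ⟩
  Σ< Q (λ i → f (i div Q)) + Σ< (q * Q) (λ i → f ((Q + i) div Q))
    ≡⟨ cong₂ _+_ (Σ<-cong Q (λ i i<Q → cong f (m<n⇒m/n≡0 i<Q)))
                 (Σ<-cong (q * Q) (λ i _ → cong f (shift i))) ⟩
  Σ< Q (λ _ → f 0) + Σ< (q * Q) (λ i → f (suc (i div Q)))
    ≡⟨ cong₂ _+_ (Σ<-const Q (f 0)) (Σ<-div q Q (λ r → f (suc r))) ⟩
  Q * f 0 + Q * Σ< q (λ r → f (suc r))
    ≡⟨ sym (*-distribˡ-+ Q (f 0) _) ⟩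
  Q * Σ< (suc q) f ∎
  where
  open ≡-Reasoning
  shift : ∀ i → (Q + i) div Q ≡ suc (i div Q)
  shift i = trans (+-distrib-/-∣ˡ i (∣-refl {Q})) (cong (_+ i div Q) (n/n≡1 Q))

ΣFin : ∀ n → (Fin n → ℕ) → ℕ
ΣFin zero    f = 0
ΣFin (suc n) f = f zero + ΣFin n (λ i → f (suc i))

ΣFin-cong : ∀ n {f g : Fin n → ℕ} → (∀ i → f i ≡ g i) → ΣFin n f ≡ ΣFin n g
ΣFin-cong zero    f≡g = refl
ΣFin-cong (suc n) f≡g = cong₂ _+_ (f≡g zero) (ΣFin-cong n (λ i → f≡g (suc i)))

ΣFin-mono : ∀ n {f g : Fin n → ℕ} → (∀ i → f i ≤ g i) → ΣFin n f ≤ ΣFin n g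
ΣFin-mono zero    f≤g = z≤n
ΣFin-mono (suc n) f≤g = +-mono-≤ (f≤g zero) (ΣFin-mono n (λ i → f≤g (suc i)))

ΣFin-+ : ∀ n (f g : Fin n → ℕ) → ΣFin n (λ i → f i + g i) ≡ ΣFin n f + ΣFin n g
ΣFin-+ zero    f g = refl
ΣFin-+ (suc n) f g =
  trans (cong (f zero + g zero +_) (ΣFin-+ n (λ i → f (suc i)) (λ i → g (suc i))))
        (+-exch (f zero) (g zero) _ _)
  where
  +-exch : ∀ a b c d → a + b + (c + d) ≡ a + c + (b + d)
  +-exch = solve-∀

ΣFin-*ˡ : ∀ n k (f : Fin n → ℕ) → ΣFin n (λ i → k * f i) ≡ k * ΣFin n f
ΣFin-*ˡ zero    k f = sym (*-zeroʳ k)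
ΣFin-*ˡ (suc n) k f = trans (cong (k * f zero +_) (ΣFin-*ˡ n k (λ i → f (suc i))))
                            (sym (*-distribˡ-+ k (f zero) _))

ΣFin-const : ∀ n k → ΣFin n (λ _ → k) ≡ n * k
ΣFin-const zero    k = refl
ΣFin-const (suc n) k = cong (k +_) (ΣFin-const n k)

ΣFin-toℕ : ∀ n (f : ℕ → ℕ) → ΣFin n (λ i → f (toℕ i)) ≡ Σ< n f
ΣFin-toℕ zero    f = refl
ΣFin-toℕ (suc n) f = cong (f 0 +_) (ΣFin-toℕ n (λ i → f (suc i)))

ΣFin-↑ : ∀ a b (f : Fin (a + b) → ℕ) →
  ΣFin (a + b) f ≡ ΣFin a (λ i → f (i ↑ˡ b)) + ΣFin b (λ i → f (a ↑ʳ i))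
ΣFin-↑ zero    b f = refl
ΣFin-↑ (suc a) b f = trans (cong (f zero +_) (ΣFin-↑ a b (λ i → f (suc i))))
                           (sym (+-assoc (f zero) _ _))

left right : ∀ {A : Set} h → (Fin (2 ^ suc h) → A) → Fin (2 ^ h) → A
left  h x i = x (i ↑ˡ (2 ^ h + 0))
right h x i = x (2 ^ h ↑ʳ (i ↑ˡ 0))

ΣFin-halves : ∀ h (f : Fin (2 ^ suc h) → ℕ) →
  ΣFin (2 ^ suc h) f ≡ ΣFin (2 ^ h) (left h f) + ΣFin (2 ^ h) (right h f)
ΣFin-halves h f = trans (ΣFin-↑ (2 ^ h) (2 ^ h + 0) f)
  (cong (ΣFin (2 ^ h) (left h f) +_)
        (trans (ΣFin-↑ (2 ^ h) 0 (λ i → f (2 ^ h ↑ʳ i))) (+-identityʳ _)))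

ones : ∀ n → (Fin n → Bool) → ℕ
ones n x = ΣFin n (λ i → χ (x i))
hamming : ∀ n → (Fin n → Bool) → (Fin n → Bool) → ℕ
hamming n x y = ΣFin n (λ i → χ (x i xor y i))

hamming-comm : ∀ n x y → hamming n x y ≡ hamming n y x
hamming-comm n x y = ΣFin-cong n (λ i → cong χ (xor-comm (x i) (y i)))

dist≡hamming : ∀ {n} (x y : Vec Bool n) → dist x y ≡ hamming n (lookup x) (lookup y)
dist≡hamming []      []      = refl
dist≡hamming (a ∷ x) (b ∷ y) = cong (χ (a xor b) +_) (dist≡hamming x y)

ones∸ones≤hamming : ∀ n x y → ones n x ∸ ones n y ≤ hamming n x y
ones∸ones≤hamming n x y = m≤n+o⇒m∸n≤o (ones n x) (ones n y) (begin
  ones n x                                           ≤⟨ ΣFin-mono n (λ i → χ≤χ+χxor (x i) (y i)) ⟩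
  ΣFin n (λ i → χ (y i) + χ (x i xor y i))           ≡⟨ ΣFin-+ n _ _ ⟩
  ones n y + hamming n x y                           ∎)
  where
  open ≤-Reasoning
  χ≤χ+χxor : ∀ a b → χ a ≤ χ b + χ (a xor b)
  χ≤χ+χxor false b     = z≤n
  χ≤χ+χxor true  false = s≤s z≤n
  χ≤χ+χxor true  true  = s≤s z≤n

Consistent : ℕ → Sym → ℕ → Set
Consistent L s0 o = o ≡ 0
Consistent L s1 o = o ≡ L
Consistent L F0 o = 2 * o ≤ L
Consistent L P  o = 2 * o ≤ L
Consistent L F1 o = ⊤

≤half-+ : ∀ {L} a b → 2 * a ≤ L → 2 * b ≤ L → 2 * (a + b) ≤ 2 * L
≤half-+ {L} a b p q = begin
  2 * (a + b)   ≡⟨ *-distribˡ-+ 2 a b ⟩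
  2 * a + 2 * b ≤⟨ +-mono-≤ p q ⟩
  L + L         ≡⟨ cong (L +_) (sym (+-identityʳ L)) ⟩
  2 * L         ∎
  where open ≤-Reasoning

gate-consistent : ∀ L a b o₁ o₂ → Consistent L a o₁ → Consistent L b o₂ →
  Consistent (2 * L) (gate a b) (o₁ + o₂)
gate-consistent L F1 b  o₁ o₂ c₁ c₂ = tt
gate-consistent L s0 F1 o₁ o₂ c₁ c₂ = tt
gate-consistent L F0 F1 o₁ o₂ c₁ c₂ = tt
gate-consistent L P  F1 o₁ o₂ c₁ c₂ = tt
gate-consistent L s1 F1 o₁ o₂ c₁ c₂ = tt
gate-consistent L s1 P  o₁ o₂ c₁ c₂ = tt
gate-consistent L P  s1 o₁ o₂ c₁ c₂ = tt
gate-consistent L F0 s1 o₁ o₂ c₁ c₂ = tt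
gate-consistent L s1 F0 o₁ o₂ c₁ c₂ = tt
gate-consistent L s0 s0 o₁ o₂ refl refl = refl
gate-consistent L s1 s1 o₁ o₂ refl refl = cong (L +_) (sym (+-identityʳ L))
gate-consistent L s1 s0 o₁ o₂ refl refl = ≤-reflexive (cong (2 *_) (+-identityʳ L))
gate-consistent L s0 s1 o₁ o₂ refl refl = ≤-refl
gate-consistent L P  P  o₁ o₂ c₁ c₂ = ≤half-+ o₁ o₂ c₁ c₂
gate-consistent L P  F0 o₁ o₂ c₁ c₂ = ≤half-+ o₁ o₂ c₁ c₂
gate-consistent L F0 P  o₁ o₂ c₁ c₂ = ≤half-+ o₁ o₂ c₁ c₂
gate-consistent L F0 F0 o₁ o₂ c₁ c₂ = ≤half-+ o₁ o₂ c₁ c₂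
gate-consistent L s0 P  o₁ o₂ refl c₂ = ≤half-+ 0 o₂ z≤n c₂
gate-consistent L s0 F0 o₁ o₂ refl c₂ = ≤half-+ 0 o₂ z≤n c₂
gate-consistent L P  s0 o₁ o₂ c₁ refl = ≤half-+ o₁ 0 c₁ z≤n
gate-consistent L F0 s0 o₁ o₂ c₁ refl = ≤half-+ o₁ 0 c₁ z≤n

evalF-consistent : ∀ h x → Consistent (2 ^ h) (evalF h x) (ones (2 ^ h) x)
evalF-consistent zero x with x zero
... | false = refl
... | true  = refl
evalF-consistent (suc h) x =
  subst (Consistent (2 ^ suc h) (evalF (suc h) x)) (sym (ΣFin-halves h (λ i → χ (x i))))
    (gate-consistent (2 ^ h) _ _ _ _ (evalF-consistent h (left h x)) (evalF-consistent h (right h x)))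

≢F1⇒few-or-all : ∀ h y → evalF h y ≢ F1 →
  (2 * ones (2 ^ h) y ≤ 2 ^ h) ⊎ (ones (2 ^ h) y ≡ 2 ^ h)
≢F1⇒few-or-all h y ≢F1 with evalF h y | evalF-consistent h y
... | s0 | none = inj₁ (≤-trans (≤-reflexive (cong (2 *_) none)) z≤n)
... | s1 | c    = inj₂ c
... | F0 | c    = inj₁ c
... | P  | c    = inj₁ c
... | F1 | _    = ⊥-elim (≢F1 refl)

-- The distance of a number o of ones among 2L positions from the counts
-- allowed under a non-F₁ root (at most L, or exactly 2L).
defect : ℕ → ℕ → ℕ
defect L o = (o ∸ L) ⊓ (2 * L ∸ o)

defect≤hamming : ∀ h x y → evalF (suc h) y ≢ F1 →
  defect (2 ^ h) (ones (2 ^ suc h) x) ≤ hamming (2 ^ suc h) x y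
defect≤hamming h x y ≢F1 with ≢F1⇒few-or-all (suc h) y ≢F1
... | inj₁ few = begin
  defect (2 ^ h) (ones (2 ^ suc h) x) ≤⟨ m⊓n≤m _ _ ⟩
  ones (2 ^ suc h) x ∸ 2 ^ h          ≤⟨ ∸-monoʳ-≤ (ones (2 ^ suc h) x) (*-cancelˡ-≤ {ones (2 ^ suc h) y} {2 ^ h} 2 few) ⟩
  ones (2 ^ suc h) x ∸ ones (2 ^ suc h) y ≤⟨ ones∸ones≤hamming (2 ^ suc h) x y ⟩
  hamming (2 ^ suc h) x y             ∎
  where open ≤-Reasoning
... | inj₂ all = begin
  defect (2 ^ h) (ones (2 ^ suc h) x) ≤⟨ m⊓n≤n _ _ ⟩
  2 ^ suc h ∸ ones (2 ^ suc h) x      ≡⟨ cong (_∸ ones (2 ^ suc h) x) (sym all) ⟩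
  ones (2 ^ suc h) y ∸ ones (2 ^ suc h) x ≤⟨ ones∸ones≤hamming (2 ^ suc h) y x ⟩
  hamming (2 ^ suc h) y x             ≡⟨ hamming-comm (2 ^ suc h) y x ⟩
  hamming (2 ^ suc h) x y             ∎
  where open ≤-Reasoning

-- F₁ is absorbing, so below a non-F₁ root every subformula is non-F₁.
gate≢F1 : ∀ a b → gate a b ≢ F1 → (a ≢ F1) × (b ≢ F1)
gate≢F1 a b ≢F1 = (λ a≡F1 → ≢F1 (cong (λ a → gate a b) a≡F1))
                , (λ b≡F1 → ≢F1 (trans (cong (gate a) b≡F1) (gate-F1ʳ a)))
  where
  gate-F1ʳ : ∀ a → gate a F1 ≡ F1
  gate-F1ʳ s0 = refl
  gate-F1ʳ F0 = refl
  gate-F1ʳ P  = refl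
  gate-F1ʳ F1 = refl
  gate-F1ʳ s1 = refl

window : ∀ n → (ℕ → Bool) → ℕ → Fin n → Bool
window n g o i = g (o + toℕ i)
blockOnes : ℕ → (ℕ → Bool) → ℕ → ℕ
blockOnes n g o = Σ< n (λ i → χ (g (o + i)))

ones-window : ∀ n g o → ones n (window n g o) ≡ blockOnes n g o
ones-window n g o = ΣFin-toℕ n (λ i → χ (g (o + i)))

hamming-window-halves : ∀ h g o (y : Fin (2 ^ suc h) → Bool) →
  hamming (2 ^ suc h) (window _ g o) y
    ≡ hamming (2 ^ h) (window _ g o) (left h y) + hamming (2 ^ h) (window _ g (o + 2 ^ h)) (right h y)
hamming-window-halves h g o y = trans (ΣFin-halves h _) (cong₂ _+_
  (ΣFin-cong (2 ^ h) (λ i → cong (λ k → χ (g (o + k) xor left h y i)) (toℕ-↑ˡ i _)))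
  (ΣFin-cong (2 ^ h) (λ i → cong (λ k → χ (g k xor right h y i)) (right-index i))))
  where
  right-index : ∀ i → o + toℕ (2 ^ h ↑ʳ (i ↑ˡ 0)) ≡ o + 2 ^ h + toℕ i
  right-index i = trans (cong (o +_) (trans (toℕ-↑ʳ (2 ^ h) (i ↑ˡ 0)) (cong (2 ^ h +_) (toℕ-↑ˡ i 0))))
                        (sym (+-assoc o (2 ^ h) (toℕ i)))

blockDefects : ℕ → ℕ → (ℕ → Bool) → ℕ → ℕ
blockDefects h m g o = Σ< (2 ^ m) (λ j → defect (2 ^ h) (blockOnes (2 ^ suc h) g (o + j * 2 ^ suc h)))

-- Main combinatorial lemma: to reach a word whose formula (of height
-- n = m + h + 1) has a non-F₁ root, one must flip at least the total defect
-- of the blocks of length 2^(h+1), since every block is a subformula.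
blockDefects≤hamming : ∀ h m n → n ≡ m + suc h → ∀ g o (y : Fin (2 ^ n) → Bool) →
  evalF n y ≢ F1 → blockDefects h m g o ≤ hamming (2 ^ n) (window _ g o) y
blockDefects≤hamming h zero n refl g o y ≢F1 = begin
  defect (2 ^ h) (blockOnes (2 ^ suc h) g (o + 0)) + 0 ≡⟨ +-identityʳ _ ⟩
  defect (2 ^ h) (blockOnes (2 ^ suc h) g (o + 0))     ≡⟨ cong (λ k → defect (2 ^ h) (blockOnes (2 ^ suc h) g k)) (+-identityʳ o) ⟩
  defect (2 ^ h) (blockOnes (2 ^ suc h) g o)           ≡⟨ cong (defect (2 ^ h)) (sym (ones-window (2 ^ suc h) g o)) ⟩
  defect (2 ^ h) (ones (2 ^ suc h) (window _ g o))     ≤⟨ defect≤hamming h (window _ g o) y ≢F1 ⟩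
  hamming (2 ^ suc h) (window _ g o) y                 ∎
  where open ≤-Reasoning
blockDefects≤hamming h (suc m) n refl g o y ≢F1 = begin
  blockDefects h (suc m) g o
    ≡⟨ Σ<-++ (2 ^ m) (2 ^ m + 0) _ ⟩
  blockDefects h m g o + Σ< (2 ^ m + 0) (λ j → D (o + (2 ^ m + j) * B))
    ≡⟨ cong (blockDefects h m g o +_) (trans (cong (λ k → Σ< k (λ j → D (o + (2 ^ m + j) * B))) (+-identityʳ (2 ^ m)))
                                             (Σ<-cong (2 ^ m) (λ j _ → cong D (second-half-offset j)))) ⟩
  blockDefects h m g o + blockDefects h m g (o + 2 ^ n′)
    ≤⟨ +-mono-≤ (blockDefects≤hamming h m n′ refl g o (left n′ y) (proj₁ halves≢F1))
                (blockDefects≤hamming h m n′ refl g (o + 2 ^ n′) (right n′ y) (proj₂ halves≢F1)) ⟩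
  hamming (2 ^ n′) (window _ g o) (left n′ y) + hamming (2 ^ n′) (window _ g (o + 2 ^ n′)) (right n′ y)
    ≡⟨ sym (hamming-window-halves n′ g o y) ⟩
  hamming (2 ^ n) (window _ g o) y ∎
  where
  open ≤-Reasoning
  n′ : ℕ
  n′ = m + suc h
  B : ℕ
  B = 2 ^ suc h
  D : ℕ → ℕ
  D k = defect (2 ^ h) (blockOnes B g k)
  halves≢F1 : (evalF n′ (left n′ y) ≢ F1) × (evalF n′ (right n′ y) ≢ F1)
  halves≢F1 = gate≢F1 (evalF n′ (left n′ y)) (evalF n′ (right n′ y)) ≢F1
  second-half-offset : ∀ j → o + (2 ^ m + j) * B ≡ o + 2 ^ n′ + j * B
  second-half-offset j = begin-equality
    o + (2 ^ m + j) * B     ≡⟨ cong (o +_) (*-distribʳ-+ B (2 ^ m) j) ⟩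
    o + (2 ^ m * B + j * B) ≡⟨ sym (+-assoc o _ _) ⟩
    o + 2 ^ m * B + j * B   ≡⟨ cong (λ k → o + k + j * B) (sym (^-distribˡ-+-* 2 m (suc h))) ⟩
    o + 2 ^ n′ + j * B      ∎

inputBit-in-block : ∀ t {L} (z : Vec (Fin 8) L) j i → i < 2 ^ (2 + t) →
  inputBit t z (j * 2 ^ (2 + t) + i) ≡ pattern8 (at z j) ((i div 2 ^ t) {{m^n≢0 2 t}})
inputBit-in-block t z j i i<K = cong₂ (λ b q → pattern8 (at z b) ((q div 2 ^ t) {{m^n≢0 2 t}})) block-index offset
  where
  K : ℕ
  K = 2 ^ (2 + t)
  instance
    K≢0 : NonZero K
    K≢0 = m^n≢0 2 (2 + t)
  block-index : (j * K + i) div K ≡ j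
  block-index = trans (+-distrib-/-∣ˡ i (n∣m*n j))
    (trans (cong₂ _+_ (m*n/n≡m j K) (m<n⇒m/n≡0 i<K)) (+-identityʳ j))
  offset : (j * K + i) % K ≡ i
  offset = trans (cong (_% K) (+-comm (j * K) i)) (trans ([m+kn]%n≡m%n i j K) (m<n⇒m%n≡m i<K))

-- The number of ones of a pattern, and whether it is one of the four
-- patterns with a single 0 (three ones) rather than a single 1.
weight : Fin 8 → ℕ
weight c = Σ< 4 (λ q → χ (pattern8 c q))
heavy : Fin 8 → Bool
heavy c = 4 ≤ᵇ toℕ c

weight-heavy : ∀ c → weight c ≡ (if heavy c then 3 else 1)
weight-heavy zero                                      = refl
weight-heavy (suc zero)                                = refl
weight-heavy (suc (suc zero))                          = refl
weight-heavy (suc (suc (suc zero)))                    = refl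
weight-heavy (suc (suc (suc (suc zero))))              = refl
weight-heavy (suc (suc (suc (suc (suc zero)))))        = refl
weight-heavy (suc (suc (suc (suc (suc (suc zero)))))) = refl
weight-heavy (suc (suc (suc (suc (suc (suc (suc zero))))))) = refl

blockOnes-input : ∀ t {L} (z : Vec (Fin 8) L) j →
  blockOnes (2 ^ (2 + t)) (inputBit t z) (j * 2 ^ (2 + t)) ≡ 2 ^ t * weight (at z j)
blockOnes-input t z j = begin
  Σ< (2 ^ (2 + t)) (λ i → χ (inputBit t z (j * 2 ^ (2 + t) + i)))
    ≡⟨ Σ<-cong (2 ^ (2 + t)) (λ i i<K → cong χ (inputBit-in-block t z j i i<K)) ⟩
  Σ< (2 ^ (2 + t)) (λ i → χ (pattern8 (at z j) ((i div 2 ^ t) {{m^n≢0 2 t}})))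
    ≡⟨ cong (λ k → Σ< k (λ i → χ (pattern8 (at z j) ((i div 2 ^ t) {{m^n≢0 2 t}})))) (four-quarters (2 ^ t)) ⟩
  Σ< (4 * 2 ^ t) (λ i → χ (pattern8 (at z j) ((i div 2 ^ t) {{m^n≢0 2 t}})))
    ≡⟨ Σ<-div 4 (2 ^ t) {{m^n≢0 2 t}} (λ q → χ (pattern8 (at z j) q)) ⟩
  2 ^ t * weight (at z j) ∎
  where
  open ≡-Reasoning
  four-quarters : ∀ Q → 2 * (2 * Q) ≡ 4 * Q
  four-quarters = solve-∀

defect-pattern : ∀ Q b → defect (2 * Q) (Q * (if b then 3 else 1)) ≡ Q * χ b
defect-pattern Q false = begin
  (Q * 1 ∸ 2 * Q) ⊓ (2 * (2 * Q) ∸ Q * 1) ≡⟨ cong (_⊓ (2 * (2 * Q) ∸ Q * 1)) (m≤n⇒m∸n≡0 Q≤2Q) ⟩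
  0                                        ≡⟨ sym (*-zeroʳ Q) ⟩
  Q * 0                                    ∎
  where
  open ≡-Reasoning
  Q≤2Q : Q * 1 ≤ 2 * Q
  Q≤2Q = subst (_≤ 2 * Q) (sym (*-identityʳ Q)) (m≤m+n Q (Q + 0))
defect-pattern Q true = begin
  (Q * 3 ∸ 2 * Q) ⊓ (2 * (2 * Q) ∸ Q * 3)         ≡⟨ cong₂ (λ a b → (a ∸ 2 * Q) ⊓ (b ∸ Q * 3)) (three Q) (four Q) ⟩
  (2 * Q + Q ∸ 2 * Q) ⊓ (Q * 3 + Q ∸ Q * 3)       ≡⟨ cong₂ _⊓_ (m+n∸m≡n (2 * Q) Q) (m+n∸m≡n (Q * 3) Q) ⟩
  Q ⊓ Q                                          ≡⟨ ⊓-idem Q ⟩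
  Q                                              ≡⟨ sym (*-identityʳ Q) ⟩
  Q * 1                                          ∎
  where
  open ≡-Reasoning
  three : ∀ Q → Q * 3 ≡ 2 * Q + Q
  three = solve-∀
  four : ∀ Q → 2 * (2 * Q) ≡ Q * 3 + Q
  four = solve-∀

heavyCount : ∀ {L} → Vec (Fin 8) L → ℕ
heavyCount {L} z = Σ< L (λ j → χ (heavy (at z j)))

blockDefects-input : ∀ t m (z : Vec (Fin 8) (2 ^ m)) →
  blockDefects (suc t) m (inputBit t z) 0 ≡ 2 ^ t * heavyCount z
blockDefects-input t m z =
  trans (Σ<-cong (2 ^ m) (λ j _ → block-defect j)) (Σ<-*ˡ (2 ^ m) (2 ^ t) (λ j → χ (heavy (at z j))))
  where
  block-defect : ∀ j → defect (2 ^ suc t) (blockOnes (2 ^ (2 + t)) (inputBit t z) (j * 2 ^ (2 + t)))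
                     ≡ 2 ^ t * χ (heavy (at z j))
  block-defect j = trans (cong (defect (2 ^ suc t)) (trans (blockOnes-input t z j)
                                                           (cong (2 ^ t *_) (weight-heavy (at z j)))))
                         (defect-pattern (2 ^ t) (heavy (at z j)))

-- An input with more than a third of its blocks heavy is 1/12-far: every
-- satisfying y is at distance ≥ 2^t · heavyCount z > 2^(t+2+m) / 12.
far-input : ∀ t m (z : Vec (Fin 8) (2 ^ m)) → 2 ^ m < 3 * heavyCount z → Far (2 + t + m) (input t m z)
far-input t m z many y (≢F1 , _) = begin-strict
  2 ^ (2 + t + m)                     ≡⟨ ^-distribˡ-+-* 2 (2 + t) m ⟩
  2 ^ (2 + t) * 2 ^ m                 <⟨ *-monoʳ-< (2 ^ (2 + t)) {{m^n≢0 2 (2 + t)}} many ⟩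
  2 ^ (2 + t) * (3 * heavyCount z)    ≡⟨ twelve (2 ^ t) (heavyCount z) ⟩
  12 * (2 ^ t * heavyCount z)         ≡⟨ cong (12 *_) (sym (blockDefects-input t m z)) ⟩
  12 * blockDefects (suc t) m g 0     ≤⟨ *-monoʳ-≤ 12 (blockDefects≤hamming (suc t) m (2 + t + m) (+-comm (2 + t) m) g 0 (lookup y) ≢F1) ⟩
  12 * hamming (2 ^ (2 + t + m)) (window _ g 0) (lookup y) ≡⟨ cong (12 *_) (sym (hamming-input)) ⟩
  12 * dist (input t m z) y           ∎
  where
  open ≤-Reasoning
  g : ℕ → Bool
  g = inputBit t z
  twelve : ∀ Q H → 2 * (2 * Q) * (3 * H) ≡ 12 * (Q * H)
  twelve = solve-∀
  hamming-input : dist (input t m z) y ≡ hamming (2 ^ (2 + t + m)) (window _ g 0) (lookup y)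
  hamming-input = trans (dist≡hamming (input t m z) y)
    (ΣFin-cong _ (λ i → cong (λ b → χ (b xor lookup y i)) (lookup∘tabulate (λ j → g (toℕ j)) i)))

ΣV : ∀ N → (Vec (Fin 8) N → ℕ) → ℕ
ΣV zero    f = f []
ΣV (suc N) f = ΣFin 8 (λ c → ΣV N (λ v → f (c ∷ v)))

count≡ΣV : ∀ N Q → count N Q ≡ ΣV N (λ z → χ (Q z))
count≡ΣV zero    Q = refl
count≡ΣV (suc N) Q = ΣFin-cong 8 (λ c → count≡ΣV N (λ v → Q (c ∷ v)))

ΣV-cong : ∀ N {f g : Vec (Fin 8) N → ℕ} → (∀ z → f z ≡ g z) → ΣV N f ≡ ΣV N g
ΣV-cong zero    f≡g = f≡g []
ΣV-cong (suc N) f≡g = ΣFin-cong 8 (λ c → ΣV-cong N (λ v → f≡g (c ∷ v)))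
ΣV-mono : ∀ N {f g : Vec (Fin 8) N → ℕ} → (∀ z → f z ≤ g z) → ΣV N f ≤ ΣV N g
ΣV-mono zero    f≤g = f≤g []
ΣV-mono (suc N) f≤g = ΣFin-mono 8 (λ c → ΣV-mono N (λ v → f≤g (c ∷ v)))
ΣV-+ : ∀ N (f g : Vec (Fin 8) N → ℕ) → ΣV N (λ z → f z + g z) ≡ ΣV N f + ΣV N g
ΣV-+ zero    f g = refl
ΣV-+ (suc N) f g = trans (ΣFin-cong 8 (λ c → ΣV-+ N (λ v → f (c ∷ v)) (λ v → g (c ∷ v))))
                         (ΣFin-+ 8 (λ c → ΣV N (λ v → f (c ∷ v))) (λ c → ΣV N (λ v → g (c ∷ v))))
ΣV-*ˡ : ∀ N k (f : Vec (Fin 8) N → ℕ) → ΣV N (λ z → k * f z) ≡ k * ΣV N f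
ΣV-*ˡ zero    k f = refl
ΣV-*ˡ (suc N) k f = trans (ΣFin-cong 8 (λ c → ΣV-*ˡ N k (λ v → f (c ∷ v)))) (ΣFin-*ˡ 8 k (λ c → ΣV N (λ v → f (c ∷ v))))

ΣV-const : ∀ N k → ΣV N (λ _ → k) ≡ k * 8 ^ N
ΣV-const zero    k = sym (*-identityʳ k)
ΣV-const (suc N) k = begin
  ΣFin 8 (λ _ → ΣV N (λ _ → k)) ≡⟨ ΣFin-const 8 (ΣV N (λ _ → k)) ⟩
  8 * ΣV N (λ _ → k)            ≡⟨ cong (8 *_) (ΣV-const N k) ⟩
  8 * (k * 8 ^ N)               ≡⟨ *-comm-8 k (8 ^ N) ⟩
  k * (8 * 8 ^ N)               ∎
  where
  open ≡-Reasoning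
  *-comm-8 : ∀ k E → 8 * (k * E) ≡ k * (8 * E)
  *-comm-8 = solve-∀

-- Four of the eight letters are heavy.
ΣFin8-heavy : ∀ (G : Bool → ℕ) → ΣFin 8 (λ c → G (heavy c)) ≡ 4 * (G false + G true)
ΣFin8-heavy G = four-and-four (G false) (G true)
  where
  four-and-four : ∀ a b → a + (a + (a + (a + (b + (b + (b + (b + 0))))))) ≡ 4 * (a + b)
  four-and-four = solve-∀

Σ-heavyCount : ∀ N → 2 * ΣV N heavyCount ≡ N * 8 ^ N
Σ-heavyCount zero    = refl
Σ-heavyCount (suc N) = begin
  2 * ΣFin 8 (λ c → G (heavy c))                ≡⟨ cong (2 *_) (ΣFin8-heavy G) ⟩
  2 * (4 * (G false + G true))                  ≡⟨ cong (λ k → 2 * (4 * (k + G true))) (G≡ false) ⟩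
  2 * (4 * (0 * E + S + G true))                ≡⟨ cong (λ k → 2 * (4 * (0 * E + S + k))) (G≡ true) ⟩
  2 * (4 * (0 * E + S + (1 * E + S)))           ≡⟨ regroup E S ⟩
  8 * E + 8 * (2 * S)                           ≡⟨ cong (λ k → 8 * E + 8 * k) (Σ-heavyCount N) ⟩
  8 * E + 8 * (N * E)                           ≡⟨ factor E N ⟩
  suc N * (8 * E)                               ∎
  where
  open ≡-Reasoning
  E : ℕ
  E = 8 ^ N
  S : ℕ
  S = ΣV N heavyCount
  G : Bool → ℕ
  G b = ΣV N (λ v → χ b + heavyCount v)
  G≡ : ∀ b → G b ≡ χ b * E + S
  G≡ b = trans (ΣV-+ N (λ _ → χ b) heavyCount) (cong (_+ S) (ΣV-const N (χ b)))
  regroup : ∀ E S → 2 * (4 * (0 * E + S + (1 * E + S))) ≡ 8 * E + 8 * (2 * S)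
  regroup = solve-∀
  factor : ∀ E N → 8 * E + 8 * (N * E) ≡ suc N * (8 * E)
  factor = solve-∀

Σ-heavyCount² : ∀ N → 4 * ΣV N (λ z → heavyCount z * heavyCount z) ≡ N * suc N * 8 ^ N
Σ-heavyCount² zero    = refl
Σ-heavyCount² (suc N) = begin
  4 * ΣFin 8 (λ c → G (heavy c))                ≡⟨ cong (4 *_) (ΣFin8-heavy G) ⟩
  4 * (4 * (S₂ + G true))                       ≡⟨ cong (λ k → 4 * (4 * (S₂ + k))) G-true ⟩
  4 * (4 * (S₂ + (E + (2 * S₁ + S₂))))          ≡⟨ regroup E S₁ S₂ ⟩
  16 * E + 16 * (2 * S₁) + 8 * (4 * S₂)         ≡⟨ cong₂ (λ a b → 16 * E + 16 * a + 8 * b) (Σ-heavyCount N) (Σ-heavyCount² N) ⟩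
  16 * E + 16 * (N * E) + 8 * (N * suc N * E)   ≡⟨ factor E N ⟩
  suc N * suc (suc N) * (8 * E)                 ∎
  where
  open ≡-Reasoning
  E : ℕ
  E = 8 ^ N
  S₁ : ℕ
  S₁ = ΣV N heavyCount
  S₂ : ℕ
  S₂ = ΣV N (λ z → heavyCount z * heavyCount z)
  G : Bool → ℕ
  G b = ΣV N (λ v → (χ b + heavyCount v) * (χ b + heavyCount v))
  square-suc : ∀ x → suc x * suc x ≡ 1 + 2 * x + x * x
  square-suc = solve-∀
  G-true : G true ≡ E + (2 * S₁ + S₂)
  G-true = begin
    ΣV N (λ v → suc (heavyCount v) * suc (heavyCount v))
      ≡⟨ ΣV-cong N (λ v → square-suc (heavyCount v)) ⟩
    ΣV N (λ v → 1 + 2 * heavyCount v + heavyCount v * heavyCount v)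
      ≡⟨ ΣV-+ N _ _ ⟩
    ΣV N (λ v → 1 + 2 * heavyCount v) + S₂
      ≡⟨ cong (_+ S₂) (ΣV-+ N (λ _ → 1) (λ v → 2 * heavyCount v)) ⟩
    ΣV N (λ _ → 1) + ΣV N (λ v → 2 * heavyCount v) + S₂
      ≡⟨ cong₂ (λ a b → a + b + S₂) (trans (ΣV-const N 1) (*-identityˡ E)) (ΣV-*ˡ N 2 heavyCount) ⟩
    E + 2 * S₁ + S₂
      ≡⟨ +-assoc E _ _ ⟩
    E + (2 * S₁ + S₂) ∎
  regroup : ∀ E S₁ S₂ → 4 * (4 * (S₂ + (E + (2 * S₁ + S₂)))) ≡ 16 * E + 16 * (2 * S₁) + 8 * (4 * S₂)
  regroup = solve-∀
  factor : ∀ E N → 16 * E + 16 * (N * E) + 8 * (N * suc N * E) ≡ suc N * suc (suc N) * (8 * E)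
  factor = solve-∀

-- 2ab ≤ a² + b², i.e. (a - b)² ≥ 0.
2ab≤a²+b² : ∀ a b → 2 * a * b ≤ a * a + b * b
2ab≤a²+b² a b with ≤-total a b
... | inj₁ a≤b with m≤n⇒∃[o]m+o≡n a≤b
...   | d , refl = m+n≤o⇒m≤o (2 * a * (a + d)) (≤-reflexive (expand a d))
  where
  expand : ∀ a d → 2 * a * (a + d) + d * d ≡ a * a + (a + d) * (a + d)
  expand = solve-∀
2ab≤a²+b² a b | inj₂ b≤a with m≤n⇒∃[o]m+o≡n b≤a
...   | d , refl = m+n≤o⇒m≤o (2 * (b + d) * b) (≤-reflexive (expand b d))
  where
  expand : ∀ b d → 2 * (b + d) * b + d * d ≡ (b + d) * (b + d) + b * b
  expand = solve-∀

manyHeavy : ∀ N → Vec (Fin 8) N → Bool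
manyHeavy N z = does (N <? 3 * heavyCount z)

-- Pointwise Chebyshev bound: (6x - 3N)² ≥ N² whenever 3x ≤ N.
-- (Stated for any decision d of N < 3x, so that the case split is on d.)
chebyshev-pointwise : ∀ N x (d : Dec (N < 3 * x)) →
  N * N * χ (not (does d)) + 36 * N * x ≤ 9 * N * N + 36 * (x * x)
chebyshev-pointwise N x (yes _) = begin
  N * N * 0 + 36 * N * x      ≡⟨ as-product N x ⟩
  2 * (3 * N) * (6 * x)       ≤⟨ 2ab≤a²+b² (3 * N) (6 * x) ⟩
  3 * N * (3 * N) + 6 * x * (6 * x) ≡⟨ as-squares N x ⟩
  9 * N * N + 36 * (x * x)    ∎
  where
  open ≤-Reasoning
  as-product : ∀ N x → N * N * 0 + 36 * N * x ≡ 2 * (3 * N) * (6 * x)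
  as-product = solve-∀
  as-squares : ∀ N x → 3 * N * (3 * N) + 6 * x * (6 * x) ≡ 9 * N * N + 36 * (x * x)
  as-squares = solve-∀
chebyshev-pointwise N x (no N≮3x) with m≤n⇒∃[o]m+o≡n (≮⇒≥ N≮3x)
...   | d , refl = m+n≤o⇒m≤o (N * N * 1 + 36 * N * x) (≤-reflexive (expand x d))
  where
  expand : ∀ x d → (3 * x + d) * (3 * x + d) * 1 + 36 * (3 * x + d) * x + (12 * x * d + 8 * d * d)
                 ≡ 9 * (3 * x + d) * (3 * x + d) + 36 * (x * x)
  expand = solve-∀

-- Chebyshev's inequality: at most 9 · 8^N / N of the 8^N words have at most a
-- third heavy letters.  Sum the pointwise bound and insert the two moments.
chebyshev : ∀ N .{{_ : NonZero N}} → N * count N (λ z → not (manyHeavy N z)) ≤ 9 * 8 ^ N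
chebyshev N = *-cancelˡ-≤ N (+-cancelʳ-≤ (18 * N * (N * E)) (N * (N * B)) (N * (9 * E)) (begin
  N * (N * B) + 18 * N * (N * E)     ≡⟨ cong₂ (λ a b → N * (N * a) + 18 * N * b) (count≡ΣV N _) (sym (Σ-heavyCount N)) ⟩
  N * (N * Bs) + 18 * N * (2 * S₁)   ≡⟨ lhs N Bs S₁ ⟩
  N * N * Bs + 36 * N * S₁           ≡⟨ cong₂ _+_ (sym (ΣV-*ˡ N (N * N) _)) (sym (ΣV-*ˡ N (36 * N) heavyCount)) ⟩
  ΣV N (λ z → N * N * χ (bad z)) + ΣV N (λ z → 36 * N * heavyCount z)
                                     ≡⟨ sym (ΣV-+ N _ _) ⟩
  ΣV N (λ z → N * N * χ (bad z) + 36 * N * heavyCount z)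
                                     ≤⟨ ΣV-mono N (λ z → chebyshev-pointwise N (heavyCount z) (N <? 3 * heavyCount z)) ⟩
  ΣV N (λ z → 9 * N * N + 36 * (heavyCount z * heavyCount z))
                                     ≡⟨ ΣV-+ N _ _ ⟩
  ΣV N (λ _ → 9 * N * N) + ΣV N (λ z → 36 * (heavyCount z * heavyCount z))
                                     ≡⟨ cong₂ _+_ (ΣV-const N (9 * N * N)) (ΣV-*ˡ N 36 _) ⟩
  9 * N * N * E + 36 * S₂            ≡⟨ cong (9 * N * N * E +_) (*-assoc 9 4 S₂) ⟩
  9 * N * N * E + 9 * (4 * S₂)       ≡⟨ cong (λ a → 9 * N * N * E + 9 * a) (Σ-heavyCount² N) ⟩
  9 * N * N * E + 9 * (N * suc N * E) ≡⟨ rhs N E ⟩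
  N * (9 * E) + 18 * N * (N * E)     ∎))
  where
  open ≤-Reasoning
  E : ℕ
  E = 8 ^ N
  bad : Vec (Fin 8) N → Bool
  bad z = not (manyHeavy N z)
  B : ℕ
  B = count N bad
  Bs : ℕ
  Bs = ΣV N (λ z → χ (bad z))
  S₁ : ℕ
  S₁ = ΣV N heavyCount
  S₂ : ℕ
  S₂ = ΣV N (λ z → heavyCount z * heavyCount z)
  lhs : ∀ N B S → N * (N * B) + 18 * N * (2 * S) ≡ N * N * B + 36 * N * S
  lhs = solve-∀
  rhs : ∀ N E → 9 * N * N * E + 9 * (N * suc N * E) ≡ N * (9 * E) + 18 * N * (N * E)
  rhs = solve-∀

count-complement : ∀ N Q → count N Q + count N (λ z → not (Q z)) ≡ 8 ^ N
count-complement N Q = begin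
  count N Q + count N (λ z → not (Q z))
    ≡⟨ cong₂ _+_ (count≡ΣV N Q) (count≡ΣV N (λ z → not (Q z))) ⟩
  ΣV N (λ z → χ (Q z)) + ΣV N (λ z → χ (not (Q z)))
    ≡⟨ sym (ΣV-+ N _ _) ⟩
  ΣV N (λ z → χ (Q z) + χ (not (Q z)))
    ≡⟨ ΣV-cong N (λ z → χ+χnot (Q z)) ⟩
  ΣV N (λ _ → 1)
    ≡⟨ trans (ΣV-const N 1) (*-identityˡ (8 ^ N)) ⟩
  8 ^ N ∎
  where
  open ≡-Reasoning
  χ+χnot : ∀ b → χ b + χ (not b) ≡ 1
  χ+χnot true  = refl
  χ+χnot false = refl

count-mono : ∀ N (Q R : Vec (Fin 8) N → Bool) → (∀ z → Q z ≡ true → R z ≡ true) → count N Q ≤ count N R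
count-mono N Q R Q⇒R = subst₂ _≤_ (sym (count≡ΣV N Q)) (sym (count≡ΣV N R)) (ΣV-mono N (λ z → χ-mono (Q⇒R z)))
  where
  χ-mono : ∀ {a b} → (a ≡ true → b ≡ true) → χ a ≤ χ b
  χ-mono {false}          _   = z≤n
  χ-mono {true}  {true}   _   = ≤-refl
  χ-mono {true}  {false} a⇒b with a⇒b refl
  ... | ()

farInput : ∀ t m → Vec (Fin 8) (2 ^ m) → Bool
farInput t m z = does (far? (2 + t + m) (input t m z))

manyHeavy⇒far : ∀ t m z → manyHeavy (2 ^ m) z ≡ true → farInput t m z ≡ true
manyHeavy⇒far t m z = decide (2 ^ m <? 3 * heavyCount z)
  where
  decide : (d : Dec (2 ^ m < 3 * heavyCount z)) → does d ≡ true → farInput t m z ≡ true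
  decide (yes many) _ = dec-true (far? (2 + t + m) (input t m z)) (far-input t m z many)
  decide (no _)     ()

far-count : ∀ t m → 2 ^ m * 8 ^ (2 ^ m) ≤ 2 ^ m * count (2 ^ m) (farInput t m) + 9 * 8 ^ (2 ^ m)
far-count t m = begin
  N * 8 ^ N                                       ≡⟨ cong (N *_) (sym (count-complement N (manyHeavy N))) ⟩
  N * (count N (manyHeavy N) + count N few)       ≡⟨ *-distribˡ-+ N _ _ ⟩
  N * count N (manyHeavy N) + N * count N few     ≤⟨ +-mono-≤ (*-monoʳ-≤ N (count-mono N _ _ (manyHeavy⇒far t m)))
                                                              (chebyshev N {{m^n≢0 2 m}}) ⟩
  N * count N (farInput t m) + 9 * 8 ^ N          ∎
  where
  open ≤-Reasoning
  N : ℕ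
  N = 2 ^ m
  few : Vec (Fin 8) N → Bool
  few z = not (manyHeavy N z)

-- Fractions (ℤ.+ a) / D of natural numbers, compared and combined by
-- cross-multiplication (via the unnormalised rationals).
toℚᵘ-/ : ∀ i D .{{_ : NonZero D}} → toℚᵘ (i / D) ≃ᵘ mkℚᵘ i (pred D)
toℚᵘ-/ i (suc d) = ℚP.toℚᵘ-fromℚᵘ (mkℚᵘ i d)

/-mono : ∀ a b D D′ .{{_ : NonZero D}} .{{_ : NonZero D′}} →
  a * D′ ≤ b * D → (ℤ.+ a) / D ≤ℚ (ℤ.+ b) / D′
/-mono a b D@(suc _) D′@(suc _) aD′≤bD = ℚP.toℚᵘ-cancel-≤
  (ℚᵘP.≤-respˡ-≃ (ℚᵘP.≃-sym (toℚᵘ-/ (ℤ.+ a) D)) (ℚᵘP.≤-respʳ-≃ (ℚᵘP.≃-sym (toℚᵘ-/ (ℤ.+ b) D′))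
    (*≤* (subst₂ ℤ._≤_ (ℤP.pos-* a D′) (ℤP.pos-* b D) (ℤ.+≤+ aD′≤bD)))))

/-cong : ∀ a b D D′ .{{_ : NonZero D}} .{{_ : NonZero D′}} →
  a * D′ ≡ b * D → (ℤ.+ a) / D ≡ (ℤ.+ b) / D′
/-cong a b D D′ aD′≡bD = ℚP.≤-antisym (/-mono a b D D′ (≤-reflexive aD′≡bD))
                                      (/-mono b a D′ D (≤-reflexive (sym aD′≡bD)))

/-+ : ∀ a b D D′ .{{_ : NonZero D}} .{{_ : NonZero D′}} →
  (ℤ.+ a) / D +ℚ (ℤ.+ b) / D′ ≡ ((ℤ.+ (a * D′ + b * D)) / (D * D′)) {{m*n≢0 D D′}}
/-+ a b D@(suc _) D′@(suc _) = ℚP.toℚᵘ-injective (begin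
  toℚᵘ ((ℤ.+ a) / D +ℚ (ℤ.+ b) / D′)            ≈⟨ ℚP.toℚᵘ-homo-+ ((ℤ.+ a) / D) ((ℤ.+ b) / D′) ⟩
  toℚᵘ ((ℤ.+ a) / D) ℚᵘ.+ toℚᵘ ((ℤ.+ b) / D′)   ≈⟨ ℚᵘP.+-cong (toℚᵘ-/ (ℤ.+ a) D) (toℚᵘ-/ (ℤ.+ b) D′) ⟩
  mkℚᵘ (ℤ.+ a) (pred D) ℚᵘ.+ mkℚᵘ (ℤ.+ b) (pred D′) ≡⟨ cong (λ n → mkℚᵘ n _) numerator ⟩
  mkℚᵘ (ℤ.+ (a * D′ + b * D)) (pred (D * D′)) ≈⟨ ℚᵘP.≃-sym (toℚᵘ-/ _ (D * D′)) ⟩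
  toℚᵘ ((ℤ.+ (a * D′ + b * D)) / (D * D′))    ∎)
  where
  open ℚᵘP.≃-Reasoning
  numerator : ℤ.+ a ℤ.* ℤ.+ D′ ℤ.+ ℤ.+ b ℤ.* ℤ.+ D ≡ ℤ.+ (a * D′ + b * D)
  numerator = trans (cong₂ ℤ._+_ (sym (ℤP.pos-* a D′)) (sym (ℤP.pos-* b D))) (sym (ℤP.pos-+ (a * D′) (b * D)))

/-* : ∀ a b D D′ .{{_ : NonZero D}} .{{_ : NonZero D′}} →
  ((ℤ.+ a) / D) *ℚ ((ℤ.+ b) / D′) ≡ ((ℤ.+ (a * b)) / (D * D′)) {{m*n≢0 D D′}}
/-* a b D@(suc _) D′@(suc _) = ℚP.toℚᵘ-injective (begin
  toℚᵘ (((ℤ.+ a) / D) *ℚ ((ℤ.+ b) / D′))            ≈⟨ ℚP.toℚᵘ-homo-* ((ℤ.+ a) / D) ((ℤ.+ b) / D′) ⟩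
  toℚᵘ ((ℤ.+ a) / D) ℚᵘ.* toℚᵘ ((ℤ.+ b) / D′)   ≈⟨ ℚᵘP.*-cong (toℚᵘ-/ (ℤ.+ a) D) (toℚᵘ-/ (ℤ.+ b) D′) ⟩
  mkℚᵘ (ℤ.+ a) (pred D) ℚᵘ.* mkℚᵘ (ℤ.+ b) (pred D′) ≡⟨ cong (λ n → mkℚᵘ n _) (sym (ℤP.pos-* a b)) ⟩
  mkℚᵘ (ℤ.+ (a * b)) (pred (D * D′))          ≈⟨ ℚᵘP.≃-sym (toℚᵘ-/ _ (D * D′)) ⟩
  toℚᵘ ((ℤ.+ (a * b)) / (D * D′))             ∎)
  where
  open ℚᵘP.≃-Reasoning

farFraction : ℕ → ℕ → ℚ
farFraction n t = ((ℤ.+ count N (farInput t (n ∸ t))) / 8 ^ N) {{m^n≢0 8 N}}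
  where
  N : ℕ
  N = 2 ^ (n ∸ t)

-- The Chebyshev failure bound 9 / 2^(n - t) for that summand.
failBound : ℕ → ℕ → ℚ
failBound n t = ((ℤ.+ 9) / 2 ^ (n ∸ t)) {{m^n≢0 2 (n ∸ t)}}

farFraction+failBound : ∀ n t → 1ℚ ≤ℚ farFraction n t +ℚ failBound n t
farFraction+failBound n t =
  subst (1ℚ ≤ℚ_) (sym (/-+ c 9 E N {{m^n≢0 8 N}} {{m^n≢0 2 m}}))
    (/-mono 1 (c * N + 9 * E) 1 (E * N) {{_}} {{m*n≢0 E N {{m^n≢0 8 N}} {{m^n≢0 2 m}}}} (begin
      1 * (E * N)        ≡⟨ lhs E N ⟩
      N * E              ≤⟨ far-count t m ⟩
      N * c + 9 * E      ≡⟨ rhs N c E ⟩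
      (c * N + 9 * E) * 1 ∎))
  where
  open ≤-Reasoning
  m : ℕ
  m = n ∸ t
  N : ℕ
  N = 2 ^ m
  E : ℕ
  E = 8 ^ N
  c : ℕ
  c = count N (farInput t m)
  lhs : ∀ E N → 1 * (E * N) ≡ N * E
  lhs = solve-∀
  rhs : ∀ N c E → N * c + 9 * E ≡ (c * N + 9 * E) * 1
  rhs = solve-∀

sumℚ-mono : ∀ n (f g : ℕ → ℚ) → (∀ t → f t ≤ℚ g t) → sumℚ n f ≤ℚ sumℚ n g
sumℚ-mono zero    f g f≤g = f≤g 0
sumℚ-mono (suc n) f g f≤g = ℚP.+-mono-≤ (sumℚ-mono n f g f≤g) (f≤g (suc n))
sumℚ-+ : ∀ n (f g : ℕ → ℚ) → sumℚ n (λ t → f t +ℚ g t) ≡ sumℚ n f +ℚ sumℚ n g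
sumℚ-+ zero    f g = refl
sumℚ-+ (suc n) f g = trans (cong (_+ℚ (f (suc n) +ℚ g (suc n))) (sumℚ-+ n f g))
                           (+ℚ-interchange (sumℚ n f) (sumℚ n g) (f (suc n)) (g (suc n)))

sumℚ-one : ∀ n → sumℚ n (λ _ → 1ℚ) ≡ (ℤ.+ suc n) / 1
sumℚ-one zero    = refl
sumℚ-one (suc n) = begin
  sumℚ n (λ _ → 1ℚ) +ℚ 1ℚ           ≡⟨ cong (_+ℚ 1ℚ) (sumℚ-one n) ⟩
  (ℤ.+ suc n) / 1 +ℚ (ℤ.+ 1) / 1    ≡⟨ /-+ (suc n) 1 1 1 ⟩
  (ℤ.+ (suc n * 1 + 1 * 1)) / 1     ≡⟨ /-cong (suc n * 1 + 1 * 1) (suc (suc n)) 1 1 (count-up n) ⟩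
  (ℤ.+ suc (suc n)) / 1             ∎
  where
  open ≡-Reasoning
  count-up : ∀ n → (suc n * 1 + 1 * 1) * 1 ≡ suc (suc n) * (1 * 1)
  count-up = solve-∀

/2^-halving : ∀ k a → ((ℤ.+ (2 * k)) / 2 ^ suc a) {{m^n≢0 2 (suc a)}} +ℚ ((ℤ.+ k) / 2 ^ a) {{m^n≢0 2 a}}
                      ≡ ((ℤ.+ (2 * k)) / 2 ^ a) {{m^n≢0 2 a}}
/2^-halving k a = trans (/-+ (2 * k) k (2 ^ suc a) (2 ^ a) {{m^n≢0 2 (suc a)}} {{m^n≢0 2 a}})
  (/-cong (2 * k * 2 ^ a + k * 2 ^ suc a) (2 * k) (2 ^ suc a * 2 ^ a) (2 ^ a)
          {{m*n≢0 (2 ^ suc a) (2 ^ a) {{m^n≢0 2 (suc a)}} {{m^n≢0 2 a}}}} {{m^n≢0 2 a}} (cross k (2 ^ a)))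
  where
  cross : ∀ k P → (2 * k * P + k * (2 * P)) * P ≡ 2 * k * (2 * P * P)
  cross = solve-∀

/-doubling : ∀ k D .{{_ : NonZero D}} → (ℤ.+ k) / D +ℚ (ℤ.+ k) / D ≡ (ℤ.+ (2 * k)) / D
/-doubling k D = trans (/-+ k k D D) (/-cong (k * D + k * D) (2 * k) (D * D) D {{m*n≢0 D D}} (cross k D))
  where
  cross : ∀ k D → (k * D + k * D) * D ≡ 2 * k * (D * D)
  cross = solve-∀

-- Σ_{t ≤ n} 9 / 2^(n - t) ≤ 18: the partial sums up to j, plus the
-- missing tail bound 9 / 2^n, are exactly 18 / 2^(n - j).
failBound-sum : ∀ n → sumℚ n (failBound n) ≤ℚ (ℤ.+ 18) / 1
failBound-sum n = begin
  sumℚ n (failBound n)              ≡⟨ sym (ℚP.+-identityʳ _) ⟩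
  sumℚ n (failBound n) +ℚ ℚ.0ℚ      ≤⟨ ℚP.+-mono-≤ (ℚP.≤-refl {sumℚ n (failBound n)}) (/-mono 0 9 1 (2 ^ n) {{_}} {{m^n≢0 2 n}} z≤n) ⟩
  sumℚ n (failBound n) +ℚ tail      ≡⟨ partial n ≤-refl ⟩
  eighteenOver (n ∸ n)              ≡⟨ cong eighteenOver (n∸n≡0 n) ⟩
  (ℤ.+ 18) / 1                      ∎
  where
  open ℚP.≤-Reasoning
  tail : ℚ
  tail = ((ℤ.+ 9) / 2 ^ n) {{m^n≢0 2 n}}
  eighteenOver : ℕ → ℚ
  eighteenOver a = ((ℤ.+ 18) / 2 ^ a) {{m^n≢0 2 a}}
  partial : ∀ j → j ≤ n → sumℚ j (failBound n) +ℚ tail ≡ eighteenOver (n ∸ j)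
  partial zero    _    = /-doubling 9 (2 ^ n) {{m^n≢0 2 n}}
  partial (suc j) j<n = begin-equality
    sumℚ j (failBound n) +ℚ failBound n (suc j) +ℚ tail
      ≡⟨ +ℚ-swap (sumℚ j (failBound n)) (failBound n (suc j)) tail ⟩
    sumℚ j (failBound n) +ℚ tail +ℚ failBound n (suc j)
      ≡⟨ cong (_+ℚ failBound n (suc j)) (partial j (<⇒≤ j<n)) ⟩
    eighteenOver (n ∸ j) +ℚ failBound n (suc j)
      ≡⟨ cong (λ a → eighteenOver a +ℚ failBound n (suc j)) (+-∸-assoc 1 j<n) ⟩
    eighteenOver (suc (n ∸ suc j)) +ℚ failBound n (suc j)
      ≡⟨ /2^-halving 9 (n ∸ suc j) ⟩
    eighteenOver (n ∸ suc j) ∎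

≤+⇒-≤ : ∀ a b c → a ≤ℚ b +ℚ c → a - c ≤ℚ b
≤+⇒-≤ a b c a≤b+c = begin
  a - c                   ≤⟨ ℚP.+-mono-≤ a≤b+c (ℚP.≤-refl {ℚ.- c}) ⟩
  b +ℚ c - c              ≡⟨ ℚP.+-assoc b c (ℚ.- c) ⟩
  b +ℚ (c - c)            ≡⟨ cong (b +ℚ_) (ℚP.+-inverseʳ c) ⟩
  b +ℚ ℚ.0ℚ               ≡⟨ ℚP.+-identityʳ b ⟩
  b                       ∎
  where open ℚP.≤-Reasoning

probFar-bound : ∀ n → 1ℚ - (ℤ.+ 18) / suc n ≤ℚ probFar n
probFar-bound n = ≤+⇒-≤ 1ℚ (probFar n) ((ℤ.+ 18) / suc n) (begin
  1ℚ                                  ≡⟨ sym r*[n+1]≡1 ⟩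
  r *ℚ ((ℤ.+ suc n) / 1)                ≤⟨ ℚP.*-monoˡ-≤-nonNeg r {{ℚP.normalize-nonNeg 1 (suc n)}} n+1≤S+18 ⟩
  r *ℚ (S +ℚ (ℤ.+ 18) / 1)            ≡⟨ ℚP.*-distribˡ-+ r S ((ℤ.+ 18) / 1) ⟩
  r *ℚ S +ℚ r *ℚ ((ℤ.+ 18) / 1)         ≡⟨ cong (r *ℚ S +ℚ_) r*18≡18/[n+1] ⟩
  probFar n +ℚ (ℤ.+ 18) / suc n       ∎)
  where
  open ℚP.≤-Reasoning
  r : ℚ
  r = (ℤ.+ 1) / suc n
  S : ℚ
  S = sumℚ n (farFraction n)
  r*[n+1]≡1 : r *ℚ ((ℤ.+ suc n) / 1) ≡ 1ℚ
  r*[n+1]≡1 = trans (/-* 1 (suc n) (suc n) 1) (/-cong (1 * suc n) 1 (suc n * 1) 1 (cross n))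
    where
    cross : ∀ n → 1 * suc n * 1 ≡ 1 * (suc n * 1)
    cross = solve-∀
  r*18≡18/[n+1] : r *ℚ ((ℤ.+ 18) / 1) ≡ (ℤ.+ 18) / suc n
  r*18≡18/[n+1] = trans (/-* 1 18 (suc n) 1) (/-cong 18 18 (suc n * 1) (suc n) (cong (18 *_) (sym (*-identityʳ (suc n)))))
  n+1≤S+18 : (ℤ.+ suc n) / 1 ≤ℚ S +ℚ (ℤ.+ 18) / 1
  n+1≤S+18 = begin
    (ℤ.+ suc n) / 1                                       ≡⟨ sym (sumℚ-one n) ⟩
    sumℚ n (λ _ → 1ℚ)                                     ≤⟨ sumℚ-mono n _ _ (farFraction+failBound n) ⟩
    sumℚ n (λ t → farFraction n t +ℚ failBound n t)       ≡⟨ sumℚ-+ n (farFraction n) (failBound n) ⟩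
    S +ℚ sumℚ n (failBound n)                             ≤⟨ ℚP.+-mono-≤ (ℚP.≤-refl {S}) (failBound-sum n) ⟩
    S +ℚ (ℤ.+ 18) / 1                                     ∎

18/[n+1]≤ε : ∀ p d .(c : Coprime (suc p) (suc d)) n → 18 * suc d ≤ n → (ℤ.+ 18) / suc n ≤ℚ mkℚ ℤ.+[1+ p ] d c
18/[n+1]≤ε p d c n H≤n = subst ((ℤ.+ 18) / suc n ≤ℚ_) (ℚP.↥p/↧p≡p (mkℚ ℤ.+[1+ p ] d c))
  (/-mono 18 (suc p) (suc n) (suc d) (begin
    18 * suc d    ≤⟨ H≤n ⟩
    n             ≤⟨ n≤1+n n ⟩
    suc n         ≤⟨ m≤n*m (suc n) (suc p) ⟩
    suc p * suc n ∎))
  where open ≤-Reasoning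

lemma7p13 : (ε : ℚ) → Positive ε →
    ∃[ H ] ((n : ℕ) → H ≤ n → (1ℚ - ε) ≤ℚ probFar n)
lemma7p13 ε@(mkℚ ℤ.+[1+ p ] d c) _ = 18 * suc d , λ n H≤n → begin
  1ℚ - ε                    ≤⟨ ℚP.+-mono-≤ (ℚP.≤-refl {1ℚ}) (ℚP.neg-antimono-≤ (18/[n+1]≤ε p d c n H≤n)) ⟩
  1ℚ - (ℤ.+ 18) / suc n     ≤⟨ probFar-bound n ⟩
  probFar n                 ∎
  where open ℚP.≤-Reasoning
lemma7p13 (mkℚ (ℤ.+ zero)   d c) ()
lemma7p13 (mkℚ ℤ.-[1+ p ] d c) ()
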